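{- Let $k\ge1$ and $0\le q<k$ be integers, and let $\lambda=M^k+\epsilon$ be a mancala configuration where $\epsilon:\mathbb N^*\to\mathbb N$ satisfies $\epsilon_1=2$, $\epsilon_i=1$ for $2\le i\le q+1$, $\epsilon_{q+2}=0$, $\epsilon_i\in\{0,1\}$ for $q+3\le i\le k+1$, and $\epsilon_i=0$ for $i>k+1$ (a $q$-biaugmented marching group). Then the depth of $\lambda$ is $q(k+2)+2$, i.e. $\Phi^{t}(\lambda)$ is an augmented marching group for $t=q(k+2)+2$ and for no smaller $t\ge0$.
   Context: A mancala configuration is $\lambda:\mathbb N^*\to\mathbb N$ whose support is $\{1,\dots,\ell\}$ for some $\ell\ge0$. Move $\Phi$: $\mu=\Phi(\lambda)$ with $\mu_i=\lambda_{i+1}+1$ for $1\le i\le\lambda_1$ and $\mu_i=\lambda_{i+1}$ for $i>\lambda_1$; $\Phi^t$ its iterate. Order is componentwise; $\lambda<\mu$ means $\lambda\le\mu$ and $\lambda\ne\mu$. Marching group $M^k$: $M^k_i=k-i+1$ for $i\le k$, $0$ otherwise. An augmented marching group is a mancala configuration $\lambda$ with $M^j\le\lambda<M^{j+1}$ for some $j\ge0$. The depth of $\lambda$ is the least $t\ge0$ with $\Phi^t(\lambda)$ an augmented marching group. -}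

module Defs where

open import Data.Nat using (ℕ; zero; suc; _+_; _*_; _∸_; _≤_; _<_; _≤ᵇ_)
open import Data.Bool using (Bool; true; false; if_then_else_; _∧_)
open import Data.Product using (Σ; _×_; ∃-syntax)
open import Relation.Binary.PropositionalEquality using (_≡_; _≢_)
open import Relation.Nullary using (¬_)
open import Function.Bundles using (_⇔_)

-- Functions ℕ* → ℕ are represented as ℕ → ℕ; the value at index 0 is
-- ignored everywhere (all quantifications below range over i ≥ 1).
Seq : Set
Seq = ℕ → ℕ

IsMancala : Seq → Set
IsMancala f = ∃[ ℓ ] (∀ i → 1 ≤ i → (f i ≢ 0 ⇔ i ≤ ℓ))

Φ : Seq → Seq
Φ f i = if (1 ≤ᵇ i) ∧ (i ≤ᵇ f 1) then suc (f (suc i)) else f (suc i)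

Φ^ : ℕ → Seq → Seq
Φ^ zero    f = f
Φ^ (suc t) f = Φ (Φ^ t f)

_≤ₛ_ : Seq → Seq → Set
f ≤ₛ g = ∀ i → 1 ≤ i → f i ≤ g i

_<ₛ_ : Seq → Seq → Set
f <ₛ g = f ≤ₛ g × ¬ (∀ i → 1 ≤ i → f i ≡ g i)

M : ℕ → Seq
M k i = if (1 ≤ᵇ i) ∧ (i ≤ᵇ k) then suc (k ∸ i) else 0

IsAugmentedMarchingGroup : Seq → Set
IsAugmentedMarchingGroup f = IsMancala f × ∃[ j ] (M j ≤ₛ f × f <ₛ M (suc j))

HasDepth : Seq → ℕ → Set
HasDepth f d = IsAugmentedMarchingGroup (Φ^ d f)
             × (∀ t → t < d → ¬ IsAugmentedMarchingGroup (Φ^ t f))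

_⊕_ : Seq → Seq → Seq
(f ⊕ g) i = f i + g i

IsBiaugmentation : ℕ → ℕ → Seq → Set
IsBiaugmentation k q ε =
    ε 1 ≡ 2
  × (∀ i → 2 ≤ i → i ≤ suc q → ε i ≡ 1)
  × ε (suc (suc q)) ≡ 0
  × (∀ i → suc (suc (suc q)) ≤ i → i ≤ suc k → ε i ≤ 1)
  × (∀ i → suc (suc k) ≤ i → ε i ≡ 0)

-- Write λ = M^k + ε and list ε₁, ε₂, … after the staircase, so λ is (2, 1^q, 0, c).  A move empties
-- the first pile, which rebuilds the staircase and deposits its surplus behind it: a leading entry
-- h ≤ 1 is rotated to the end, a leading 2 becomes two trailing 1's, the last of which absorbs
-- the next leading entry.  Hence a round of k + 2 moves takes (2, 1^(p+1), 0, c) to (2, 1^p, 0, c, 1),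
-- and after q rounds two more moves give (c′, 1, 1), which lies between M^k and M^(k+1).  Every
-- intermediate configuration contains a 0 together with a 2 (or with an entry past position k + 1),
-- so it is strictly below M^(k+1) somewhere and strictly above it elsewhere: not augmented.

module Submission where

open import Defs
open import Data.Nat using (ℕ; zero; suc; _+_; _*_; _∸_; _≤_; _<_; _≤ᵇ_; z≤n; s≤s; s≤s⁻¹)
open import Data.Nat.Properties
open import Data.Nat.Tactic.RingSolver using (solve-∀)
open import Data.Bool using (true; false; if_then_else_)
open import Data.Product using (_,_; proj₁; proj₂; ∃-syntax; _×_)
open import Data.Sum using (inj₁; inj₂)
open import Data.List using (List; []; _∷_; _++_; [_]; length; replicate; applyUpTo)
open import Data.List.Properties using (length-++; ++-assoc; ++-identityʳ; ∷ʳ-++; length-replicate; length-applyUpTo)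
open import Data.List.Membership.Propositional using (_∈_)
open import Data.List.Membership.Propositional.Properties using (∈-++⁺ˡ; ∈-++⁺ʳ)
open import Data.List.Membership.DecPropositional _≟_ using (_∈?_)
open import Data.List.Relation.Unary.Any using (here; there)
open import Data.List.Relation.Unary.All as All using (All; []; _∷_)
open import Data.List.Relation.Unary.All.Properties using (++⁺; replicate⁺; applyUpTo⁺₁)
open import Data.List.Relation.Binary.Permutation.Propositional using (_↭_)
open import Data.List.Relation.Binary.Permutation.Propositional.Properties using (∷↭∷ʳ; ↭-length; ∈-resp-↭)
open import Relation.Binary.PropositionalEquality using (_≡_; _≢_; refl; sym; trans; cong; cong₂; subst; subst₂; module ≡-Reasoning)
open import Relation.Nullary using (¬_; yes; no; ofʸ; ofⁿ; contradiction)
open import Function using (_∘_)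
open import Function.Bundles using (_⇔_; mk⇔)

private variable
  f g : Seq
  h i i′ j k m n x y d : ℕ
  t u v v′ w Q S : List ℕ

-- Equality on ℕ*; a record so that the two sequences can be inferred from a proof.
infix 4 _≈_
record _≈_ (f g : Seq) : Set where
  constructor pointwise
  field at : ∀ i → f (suc i) ≡ g (suc i)
open _≈_

≈-reflexive : f ≡ g → f ≈ g
≈-reflexive refl = pointwise λ _ → refl

≈-sym : f ≈ g → g ≈ f
≈-sym e = pointwise λ i → sym (at e i)

≈-trans : ∀ {f g h : Seq} → f ≈ g → g ≈ h → f ≈ h
≈-trans e e′ = pointwise λ i → trans (at e i) (at e′ i)

≈⇒≡-on-ℕ* : f ≈ g → ∀ i → 1 ≤ i → f i ≡ g i
≈⇒≡-on-ℕ* e (suc i) _ = at e i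

Φ-sow : ∀ f → suc i ≤ f 1 → Φ f (suc i) ≡ suc (f (2 + i))
Φ-sow {i = i} f p with suc i ≤ᵇ f 1 | ≤ᵇ-reflects-≤ (suc i) (f 1)
... | true  | _      = refl
... | false | ofⁿ ¬p = contradiction p ¬p

Φ-skip : ∀ f → f 1 < suc i → Φ f (suc i) ≡ f (2 + i)
Φ-skip {i = i} f p with suc i ≤ᵇ f 1 | ≤ᵇ-reflects-≤ (suc i) (f 1)
... | true  | ofʸ q = contradiction q (<⇒≱ p)
... | false | _     = refl

Φ-cong : f ≈ g → Φ f ≈ Φ g
Φ-cong e = pointwise λ i →
  cong₂ (λ a b → if suc i ≤ᵇ a then suc b else b) (at e 0) (at e (suc i))

Φ^-cong : ∀ n → f ≈ g → Φ^ n f ≈ Φ^ n g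
Φ^-cong zero    e = e
Φ^-cong (suc n) e = Φ-cong (Φ^-cong n e)

Φ^-Φ : ∀ n f → Φ^ n (Φ f) ≡ Φ (Φ^ n f)
Φ^-Φ zero    f = refl
Φ^-Φ (suc n) f = cong Φ (Φ^-Φ n f)

M-apply : ∀ k i → M k (suc i) ≡ k ∸ i
M-apply k i with suc i ≤ᵇ k | ≤ᵇ-reflects-≤ (suc i) k
... | true  | ofʸ p  = sym (+-∸-assoc 1 p)
... | false | ofⁿ ¬p = sym (m≤n⇒m∸n≡0 (≮⇒≥ ¬p))

M-vanishes : k ≤ i → M k (suc i) ≡ 0
M-vanishes {k = k} {i = i} p = trans (M-apply k i) (m≤n⇒m∸n≡0 p)

M-step : i < k → M k (suc i) ≡ suc (M k (2 + i))
M-step {i = i} {k = k} p = trans (M-apply k i) (trans (+-∸-assoc 1 p) (cong suc (sym (M-apply k (suc i)))))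

M-suc : i ≤ k → M (suc k) (suc i) ≡ M k (suc i) + 1
M-suc {i = i} {k = k} p = begin
  M (suc k) (suc i) ≡⟨ M-apply (suc k) i ⟩
  suc k ∸ i         ≡⟨ +-∸-assoc 1 p ⟩
  suc (k ∸ i)       ≡⟨ cong suc (M-apply k i) ⟨
  suc (M k (suc i)) ≡⟨ +-comm 1 _ ⟩
  M k (suc i) + 1   ∎
  where open ≡-Reasoning

M-monoˡ-≤ : ∀ {a b} i → a ≤ b → M a (suc i) ≤ M b (suc i)
M-monoˡ-≤ {a = a} {b = b} i p = subst₂ _≤_ (sym (M-apply a i)) (sym (M-apply b i)) (∸-monoˡ-≤ i p)

M-cancelˡ-< : ∀ {a b} i → M a (suc i) < M b (suc i) → a < b
M-cancelˡ-< i lt = ≰⇒> λ b≤a → <⇒≱ lt (M-monoˡ-≤ i b≤a)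

Aug : Seq → Set
Aug = IsAugmentedMarchingGroup

M-isAug : ∀ j → Aug (M j)
M-isAug j =
  (j , λ { (suc i) _ →
           subst (λ a → a ≢ 0 ⇔ suc i ≤ j) (sym (M-apply j i)) (mk⇔ m∸n≢0⇒n<m m>n⇒m∸n≢0) }) ,
  j , (λ _ _ → ≤-refl) , (λ { (suc i) _ → M-monoˡ-≤ i (n≤1+n j) }) ,
  λ eq → 1+n≢n (trans (sym (M-apply (suc j) 0)) (trans (sym (eq 1 (s≤s z≤n))) (M-apply j 0)))

Aug-cong : f ≈ g → Aug f → Aug g
Aug-cong e ((ℓ , support) , j , lower , upper , ≢M) =
  (ℓ , λ i p → subst (λ a → a ≢ 0 ⇔ i ≤ ℓ) (e′ i p) (support i p)) ,
  j , (λ i p → subst (M j i ≤_) (e′ i p) (lower i p)) ,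
      (λ i p → subst (_≤ M (suc j) i) (e′ i p) (upper i p)) ,
      (λ eq → ≢M λ i p → trans (e′ i p) (eq i p))
  where e′ = ≈⇒≡-on-ℕ* e

-- Lying strictly below M m at one place forces j < m, strictly above at another forces m ≤ j.
¬Aug-straddle : f (suc i) < M m (suc i) → M m (suc i′) < f (suc i′) → ¬ Aug f
¬Aug-straddle {i = i} {m = m} {i′ = i′} below above (_ , j , lower , upper , _) =
  <⇒≱ (M-cancelˡ-< {b = m} i (≤-<-trans (lower (suc i) (s≤s z≤n)) below))
      (m<1+n⇒m≤n (M-cancelˡ-< {a = m} i′ (<-≤-trans above (upper (suc i′) (s≤s z≤n)))))

HasDepth-cong : f ≈ g → HasDepth f d → HasDepth g d
HasDepth-cong {d = d} e (aug , ¬aug) =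
  Aug-cong (Φ^-cong d e) aug , λ t t<d a → ¬aug t t<d (Aug-cong (≈-sym (Φ^-cong t e)) a)

HasDepth-Φ : ¬ Aug f → HasDepth (Φ f) d → HasDepth f (suc d)
HasDepth-Φ {f = f} {d = d} ¬aug₀ (aug , ¬aug) = subst Aug (Φ^-Φ d f) aug , earlier
  where
  earlier : ∀ t → t < suc d → ¬ Aug (Φ^ t f)
  earlier zero    _        = ¬aug₀
  earlier (suc t) (s≤s t<d) = ¬aug t t<d ∘ subst Aug (sym (Φ^-Φ t f))

data Run : Seq → ℕ → Seq → Set where
  stop : Run f 0 f
  move : ∀ {f g h n} → ¬ Aug f → Φ f ≈ g → Run g n h → Run f (suc n) h

Run-HasDepth : Run f n g → HasDepth g d → HasDepth f (n + d)
Run-HasDepth stop             hd = hd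
Run-HasDepth (move ¬aug e r) hd = HasDepth-Φ ¬aug (HasDepth-cong (≈-sym e) (Run-HasDepth r hd))

lookup₀ : List ℕ → ℕ → ℕ
lookup₀ []       _       = 0
lookup₀ (x ∷ _)  zero    = x
lookup₀ (_ ∷ xs) (suc i) = lookup₀ xs i

lookup₀-++ˡ : i < length u → lookup₀ (u ++ v) i ≡ lookup₀ u i
lookup₀-++ˡ {i = zero}  {u = _ ∷ _} _         = refl
lookup₀-++ˡ {i = suc i} {u = _ ∷ u} (s≤s i<n) = lookup₀-++ˡ {u = u} i<n

lookup₀-++ʳ : length u ≡ n → lookup₀ (u ++ v) (n + j) ≡ lookup₀ v j
lookup₀-++ʳ {u = []}    refl = refl
lookup₀-++ʳ {u = _ ∷ u} refl = lookup₀-++ʳ {u = u} refl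

lookup₀-++-∷ : length u ≡ n → lookup₀ (u ++ x ∷ v) n ≡ x
lookup₀-++-∷ {u = []}    refl = refl
lookup₀-++-∷ {u = _ ∷ u} refl = lookup₀-++-∷ {u = u} refl

lookup₀-beyond : length u ≤ i → lookup₀ u i ≡ 0
lookup₀-beyond {u = []}                  _       = refl
lookup₀-beyond {u = _ ∷ u} {i = suc i} (s≤s p) = lookup₀-beyond {u = u} p

lookup₀-∈ : i < length u → lookup₀ u i ∈ u
lookup₀-∈ {i = zero}  {u = _ ∷ _} _         = here refl
lookup₀-∈ {i = suc i} {u = _ ∷ u} (s≤s i<n) = there (lookup₀-∈ i<n)

∈⇒lookup₀ : x ∈ u → ∃[ i ] (i < length u × lookup₀ u i ≡ x)
∈⇒lookup₀ (here refl) = 0 , s≤s z≤n , refl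
∈⇒lookup₀ (there x∈u) with ∈⇒lookup₀ x∈u
... | i , i<n , eq = suc i , s≤s i<n , eq

lookup₀-All : ∀ {P : ℕ → Set} → All P u → i < length u → P (lookup₀ u i)
lookup₀-All ps i<n = All.lookup ps (lookup₀-∈ i<n)

lookup₀-≤1 : All (_≤ 1) u → ∀ i → lookup₀ u i ≤ 1
lookup₀-≤1 {u = u} bits i with i <? length u
... | yes i<n = lookup₀-All bits i<n
... | no  i≮n = subst (_≤ 1) (sym (lookup₀-beyond {u = u} (≮⇒≥ i≮n))) z≤n

lookup₀-applyUpTo : ∀ (e : ℕ → ℕ) → i < n → lookup₀ (applyUpTo e n) i ≡ e i
lookup₀-applyUpTo {i = zero}  {n = suc n} e _         = refl
lookup₀-applyUpTo {i = suc i} {n = suc n} e (s≤s i<n) = lookup₀-applyUpTo (λ j → e (suc j)) i<n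

length-∷ʳ : ∀ u → length (u ++ [ x ]) ≡ suc (length u)
length-∷ʳ u = trans (length-++ u) (+-comm (length u) 1)

ones-of-bits : All (_≤ 1) u → ¬ 0 ∈ u → All (_≡ 1) u
ones-of-bits []               _  = []
ones-of-bits (z≤n     ∷ _)    0∉ = contradiction (here refl) 0∉
ones-of-bits (s≤s z≤n ∷ bits) 0∉ = refl ∷ ones-of-bits bits (λ 0∈ → 0∉ (there 0∈))

-- f ⊕ₗ l is f + ε for the ε whose values ε₁, ε₂, … are listed by l (then zero).
infixl 25 _⊕ₗ_
_⊕ₗ_ : Seq → List ℕ → Seq
(f ⊕ₗ l) i = f i + lookup₀ l (i ∸ 1)

M⊕ₗ-vanishes : length t ≤ suc k → k < i → (M k ⊕ₗ t) (suc i) ≡ 0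
M⊕ₗ-vanishes {t = t} len k<i = cong₂ _+_ (M-vanishes (<⇒≤ k<i)) (lookup₀-beyond {u = t} (≤-trans len k<i))

-- With |u| = k the first pile holds k + h stones: k of them rebuild the staircase M^k and the
-- remaining h raise the first h entries of v.
Φ-⊕ₗ : ∀ h u → length u ≡ k →
       (∀ j → j < h → lookup₀ v′ j ≡ suc (lookup₀ v j)) →
       (∀ j → h ≤ j → lookup₀ v′ j ≡ lookup₀ v j) →
       Φ (M k ⊕ₗ (h ∷ u ++ v)) ≈ M k ⊕ₗ (u ++ v′)
Φ-⊕ₗ {k = k} {v′ = v′} {v = v} h u refl raised kept = pointwise sow
  where
  start : Seq
  start = M k ⊕ₗ (h ∷ u ++ v)
  start₁ : start 1 ≡ k + h
  start₁ = cong (_+ h) (M-apply k 0)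
  past : ∀ w j → k ≤ n → M k (suc n) + lookup₀ (u ++ w) (k + j) ≡ lookup₀ w j
  past w j k≤n = cong₂ _+_ (M-vanishes k≤n) (lookup₀-++ʳ {u = u} refl)
  open ≡-Reasoning
  sow : ∀ i → Φ start (suc i) ≡ (M k ⊕ₗ (u ++ v′)) (suc i)
  sow i with i <? k
  ... | yes i<k = begin
    Φ start (suc i)
      ≡⟨ Φ-sow start (subst (suc i ≤_) (sym start₁) (≤-trans i<k (m≤m+n k h))) ⟩
    suc (M k (2 + i) + lookup₀ (u ++ v) i)
      ≡⟨ cong₂ _+_ (M-step i<k) (sym (lookup₀-++ˡ {u = u} i<k)) ⟨
    M k (suc i) + lookup₀ u i
      ≡⟨ cong (M k (suc i) +_) (lookup₀-++ˡ {u = u} i<k) ⟨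
    M k (suc i) + lookup₀ (u ++ v′) i ∎
  ... | no i≮k with m≤n⇒∃[o]m+o≡n (≮⇒≥ i≮k)
  ...   | j , refl with j <? h
  ...     | yes j<h = begin
    Φ start (suc (k + j))
      ≡⟨ Φ-sow start (subst (k + j <_) (sym start₁) (+-monoʳ-< k j<h)) ⟩
    suc (M k (2 + (k + j)) + lookup₀ (u ++ v) (k + j))
      ≡⟨ cong suc (past v j (m≤n⇒m≤1+n (m≤m+n k j))) ⟩
    suc (lookup₀ v j)                ≡⟨ raised j j<h ⟨
    lookup₀ v′ j                     ≡⟨ past v′ j (m≤m+n k j) ⟨
    (M k ⊕ₗ (u ++ v′)) (suc (k + j)) ∎
  ...     | no j≮h = begin
    Φ start (suc (k + j))
      ≡⟨ Φ-skip start (subst (_< suc (k + j)) (sym start₁) (s≤s (+-monoʳ-≤ k (≮⇒≥ j≮h)))) ⟩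
    M k (2 + (k + j)) + lookup₀ (u ++ v) (k + j)
      ≡⟨ past v j (m≤n⇒m≤1+n (m≤m+n k j)) ⟩
    lookup₀ v j                      ≡⟨ kept j (≮⇒≥ j≮h) ⟨
    lookup₀ v′ j                     ≡⟨ past v′ j (m≤m+n k j) ⟨
    (M k ⊕ₗ (u ++ v′)) (suc (k + j)) ∎

Φ-⊕ₗ-append : ∀ h u → length u ≡ k →
              (∀ j → j < h → lookup₀ v′ j ≡ 1) → (∀ j → h ≤ j → lookup₀ v′ j ≡ 0) →
              Φ (M k ⊕ₗ (h ∷ u)) ≈ M k ⊕ₗ (u ++ v′)
Φ-⊕ₗ-append {k = k} {v′ = v′} h u len raised kept =
  subst (λ w → Φ (M k ⊕ₗ (h ∷ w)) ≈ M k ⊕ₗ (u ++ v′)) (++-identityʳ u)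
    (Φ-⊕ₗ {v = []} h u len raised kept)

Φ-rotate : h ≤ 1 → length u ≡ k → Φ (M k ⊕ₗ (h ∷ u)) ≈ M k ⊕ₗ (u ++ [ h ])
Φ-rotate {u = u} z≤n len =
  Φ-⊕ₗ-append 0 u len (λ _ ()) λ { zero _ → refl ; (suc _) _ → refl }
Φ-rotate {u = u} (s≤s z≤n) len =
  Φ-⊕ₗ-append 1 u len (λ { zero _ → refl ; (suc _) (s≤s ()) }) λ { zero () ; (suc _) _ → refl }

Φ-split : length u ≡ k → Φ (M k ⊕ₗ (2 ∷ u)) ≈ M k ⊕ₗ (u ++ 1 ∷ 1 ∷ [])
Φ-split {u = u} len = Φ-⊕ₗ-append 2 u len
  (λ { zero _ → refl ; (suc zero) _ → refl ; (suc (suc _)) (s≤s (s≤s ())) })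
  (λ { (suc (suc _)) _ → refl ; (suc zero) (s≤s ()) })

Φ-merge : h ≤ 1 → length u ≡ k → Φ (M k ⊕ₗ (h ∷ u ++ [ y ])) ≈ M k ⊕ₗ (u ++ [ y + h ])
Φ-merge {u = u} {y = y} z≤n len =
  Φ-⊕ₗ 0 u len (λ _ ()) λ { zero _ → +-identityʳ y ; (suc _) _ → refl }
Φ-merge {u = u} {y = y} (s≤s z≤n) len =
  Φ-⊕ₗ 1 u len (λ { zero _ → +-comm y 1 ; (suc _) (s≤s ()) }) λ { zero () ; (suc _) _ → refl }

¬Aug-hole : i ≤ k → lookup₀ t i ≡ 0 → M (suc k) (suc i′) < (M k ⊕ₗ t) (suc i′) → ¬ Aug (M k ⊕ₗ t)
¬Aug-hole {i = i} {k = k} {t = t} i≤k hole above =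
  ¬Aug-straddle {f = M k ⊕ₗ t} {i = i} {m = suc k} below above
  where
  below : (M k ⊕ₗ t) (suc i) < M (suc k) (suc i)
  below = subst₂ _<_ (cong (M k (suc i) +_) (sym hole)) (sym (M-suc i≤k))
                 (+-monoʳ-< (M k (suc i)) (s≤s z≤n))

¬Aug-hole-and-2 : length t ≤ suc k → 0 ∈ t → 2 ∈ t → ¬ Aug (M k ⊕ₗ t)
¬Aug-hole-and-2 {t = t} {k = k} len 0∈ 2∈ with ∈⇒lookup₀ 0∈ | ∈⇒lookup₀ 2∈
... | i , i<n , hole | i′ , i′<n , two = ¬Aug-hole {t = t} (index i<n) hole above
  where
  index : ∀ {i} → i < length t → i ≤ k
  index i<n = s≤s⁻¹ (≤-trans i<n len)
  above : M (suc k) (suc i′) < (M k ⊕ₗ t) (suc i′)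
  above = subst₂ _<_ (sym (M-suc (index i′<n))) (cong (M k (suc i′) +_) (sym two))
                 (+-monoʳ-< (M k (suc i′)) (n<1+n 1))

¬Aug-hole-and-overflow : length u ≡ suc k → 0 ∈ u → ¬ Aug (M k ⊕ₗ (u ++ suc y ∷ v))
¬Aug-hole-and-overflow {u = u} {k = k} {y = y} {v = v} len 0∈ with ∈⇒lookup₀ 0∈
... | i , i<n , hole =
  ¬Aug-hole {k = k} {t = u ++ suc y ∷ v} {i′ = suc k}
    (s≤s⁻¹ (subst (i <_) len i<n)) (trans (lookup₀-++ˡ {u = u} i<n) hole) above
  where
  above : M (suc k) (2 + k) < (M k ⊕ₗ (u ++ suc y ∷ v)) (2 + k)
  above = subst₂ _<_ (sym (M-vanishes {k = suc k} ≤-refl))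
                 (cong (M k (2 + k) +_) (sym (lookup₀-++-∷ {u = u} len)))
                 (≤-trans (s≤s z≤n) (m≤n+m (suc y) (M k (2 + k))))

⊕ₗ-isMancala : length t ≡ suc k → lookup₀ t k ≢ 0 → IsMancala (M k ⊕ₗ t)
⊕ₗ-isMancala {t = t} {k = k} len last≢0 = suc k , λ { (suc i) _ → mk⇔ (inside i) (nonzero i) }
  where
  inside : ∀ i → (M k ⊕ₗ t) (suc i) ≢ 0 → suc i ≤ suc k
  inside i ≢0 with i ≤? k
  ... | yes i≤k = s≤s i≤k
  ... | no  i≰k = contradiction (M⊕ₗ-vanishes {t = t} (≤-reflexive len) (≰⇒> i≰k)) ≢0
  nonzero : ∀ i → suc i ≤ suc k → (M k ⊕ₗ t) (suc i) ≢ 0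
  nonzero i (s≤s i≤k) with m≤n⇒m<n∨m≡n i≤k
  ... | inj₁ i<k  = λ eq → m>n⇒m∸n≢0 i<k (trans (sym (M-apply k i)) (m+n≡0⇒m≡0 _ eq))
  ... | inj₂ refl = λ eq → last≢0 (m+n≡0⇒n≡0 (M k (suc i)) eq)

⊕ₗ-≤-M-suc : length t ≤ suc k → All (_≤ 1) t → M k ⊕ₗ t ≤ₛ M (suc k)
⊕ₗ-≤-M-suc {t = t} {k = k} len bits (suc i) _ with i ≤? k
... | yes i≤k = subst ((M k ⊕ₗ t) (suc i) ≤_) (sym (M-suc i≤k))
                      (+-monoʳ-≤ (M k (suc i)) (lookup₀-≤1 bits i))
... | no  i≰k = subst (_≤ M (suc k) (suc i)) (sym (M⊕ₗ-vanishes {t = t} len (≰⇒> i≰k))) z≤n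

⊕ₗ-≈-M-suc : length t ≡ suc k → All (_≡ 1) t → M k ⊕ₗ t ≈ M (suc k)
⊕ₗ-≈-M-suc {t = t} {k = k} len ones = pointwise entry
  where
  entry : ∀ i → (M k ⊕ₗ t) (suc i) ≡ M (suc k) (suc i)
  entry i with i ≤? k
  ... | yes i≤k = trans (cong (M k (suc i) +_) (lookup₀-All ones (subst (i <_) (sym len) (s≤s i≤k))))
                        (sym (M-suc i≤k))
  ... | no  i≰k = trans (M⊕ₗ-vanishes {t = t} (≤-reflexive len) (≰⇒> i≰k)) (sym (M-vanishes (≰⇒> i≰k)))

-- Without a zero entry the configuration is M^(k+1) itself, otherwise it is strictly below it.
⊕ₗ-isAug : length t ≡ suc k → All (_≤ 1) t → lookup₀ t k ≢ 0 → Aug (M k ⊕ₗ t)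
⊕ₗ-isAug {t = t} {k = k} len bits last≢0 with 0 ∈? t
... | no 0∉ = Aug-cong (≈-sym (⊕ₗ-≈-M-suc len (ones-of-bits bits 0∉))) (M-isAug (suc k))
... | yes 0∈ with ∈⇒lookup₀ 0∈
...   | i , i<n , hole =
  ⊕ₗ-isMancala {t = t} len last≢0 , k ,
  (λ _ _ → m≤m+n _ _) , ⊕ₗ-≤-M-suc {t = t} (≤-reflexive len) bits ,
  λ eq → 0≢1+n (+-cancelˡ-≡ (M k (suc i)) _ _
                  (trans (cong (M k (suc i) +_) (sym hole))
                         (trans (eq (suc i) (s≤s z≤n)) (M-suc (s≤s⁻¹ (subst (i <_) len i<n))))))

rotate : length (Q ++ S) ≡ suc k → All (_≤ 1) Q → 2 ∈ S → 0 ∈ Q ++ S →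
         Run (M k ⊕ₗ (Q ++ S)) (length Q) (M k ⊕ₗ (S ++ Q))
rotate {Q = []} {S = S} _ _ _ _ = subst (Run _ 0) (cong (M _ ⊕ₗ_) (sym (++-identityʳ S))) stop
rotate {Q = x ∷ Q} {S = S} {k = k} len (x≤1 ∷ bits) 2∈S 0∈ =
  move (¬Aug-hole-and-2 (≤-reflexive len) 0∈ (there (∈-++⁺ʳ Q 2∈S)))
       (≈-trans (Φ-rotate x≤1 (suc-injective len)) (≈-reflexive (cong (M k ⊕ₗ_) (++-assoc Q S [ x ]))))
       (subst (Run _ _) (cong (M k ⊕ₗ_) (∷ʳ-++ S x Q))
         (rotate (trans (sym (↭-length rotated)) len) bits (∈-++⁺ˡ 2∈S) (∈-resp-↭ rotated 0∈)))
  where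
  rotated : x ∷ Q ++ S ↭ Q ++ (S ++ [ x ])
  rotated = subst (x ∷ Q ++ S ↭_) (++-assoc Q S [ x ]) (∷↭∷ʳ x (Q ++ S))

split-merge : x ≤ 1 → length (x ∷ w) ≡ k → 0 ∈ x ∷ w →
              Run (M k ⊕ₗ (2 ∷ x ∷ w)) 2 (M k ⊕ₗ ((w ++ [ 1 ]) ++ [ 1 + x ]))
split-merge {x = x} {w = w} {k = k} x≤1 len 0∈ =
  move (¬Aug-hole-and-2 (≤-reflexive (cong suc len)) (there 0∈) (here refl))
       (≈-trans (Φ-split len) (≈-reflexive (cong (λ l → M k ⊕ₗ (x ∷ l)) (sym (++-assoc w [ 1 ] [ 1 ])))))
  (move (¬Aug-hole-and-overflow {u = x ∷ w ++ [ 1 ]} (cong suc (trans (length-∷ʳ w) len)) (∈-++⁺ˡ 0∈))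
        (Φ-merge x≤1 (trans (length-∷ʳ w) len))
  stop)

round-time : ∀ k p → 2 + (k + (p * (k + 2) + 2)) ≡ suc p * (k + 2) + 2
round-time = solve-∀

depth-from : ∀ p {c} → length (replicate p 1 ++ 0 ∷ c) ≡ k → All (_≤ 1) c →
             HasDepth (M k ⊕ₗ (2 ∷ replicate p 1 ++ 0 ∷ c)) (p * (k + 2) + 2)
depth-from {k = k} zero {c} len bits =
  Run-HasDepth (split-merge z≤n len (here refl))
    (⊕ₗ-isAug (trans (length-∷ʳ (c ++ [ 1 ])) (cong suc (trans (length-∷ʳ c) len)))
              (++⁺ (++⁺ bits (≤-refl ∷ [])) (≤-refl ∷ []))
              (λ eq → 1+n≢0 (trans (sym last) eq)) ,
     λ _ ())
  where
  last : lookup₀ ((c ++ [ 1 ]) ++ [ 1 ]) k ≡ 1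
  last = lookup₀-++-∷ {u = c ++ [ 1 ]} (trans (length-∷ʳ c) len)
depth-from {k = k} (suc p) {c} len bits =
  subst (HasDepth _) (trans (cong (λ n → 2 + (n + _)) lenQ) (round-time k p))
    (Run-HasDepth (split-merge (s≤s z≤n) len (there 0∈B))
      (Run-HasDepth (rotate (trans (length-∷ʳ (B ++ [ 1 ])) (cong suc lenQ))
                            (++⁺ (++⁺ (replicate⁺ p ≤-refl) (z≤n ∷ bits)) (≤-refl ∷ []))
                            (here refl) (∈-++⁺ˡ (∈-++⁺ˡ 0∈B)))
        (subst (λ w → HasDepth (M k ⊕ₗ (2 ∷ w)) _) (sym reassoc)
          (depth-from p (trans (cong length (sym reassoc)) lenQ) (++⁺ bits (≤-refl ∷ []))))))
  where
  B = replicate p 1 ++ 0 ∷ c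
  0∈B : 0 ∈ B
  0∈B = ∈-++⁺ʳ (replicate p 1) (here refl)
  lenQ : length (B ++ [ 1 ]) ≡ k
  lenQ = trans (length-∷ʳ B) len
  reassoc : B ++ [ 1 ] ≡ replicate p 1 ++ 0 ∷ c ++ [ 1 ]
  reassoc = ++-assoc (replicate p 1) (0 ∷ c) [ 1 ]

freeBits : ℕ → ℕ → Seq → List ℕ
freeBits k q ε = applyUpTo (λ j → ε (3 + q + j)) (k ∸ suc q)

module _ {k q : ℕ} {ε : Seq} (q<k : q < k) (biaug : IsBiaugmentation k q ε) where

  private
    ε₁≡2     = proj₁ biaug
    ones     = proj₁ (proj₂ biaug)
    hole     = proj₁ (proj₂ (proj₂ biaug))
    bits     = proj₁ (proj₂ (proj₂ (proj₂ biaug)))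
    vanishes = proj₂ (proj₂ (proj₂ (proj₂ biaug)))

  freeBits-≤1 : All (_≤ 1) (freeBits k q ε)
  freeBits-≤1 = applyUpTo⁺₁ _ _ λ {j} j<n →
    bits (3 + q + j) (m≤m+n (3 + q) j)
         (s≤s (subst (suc q + j <_) (m+[n∸m]≡n q<k) (+-monoʳ-< (suc q) j<n)))

  lookup₀-freeBits : ∀ j → lookup₀ (freeBits k q ε) j ≡ ε (3 + q + j)
  lookup₀-freeBits j with j <? k ∸ suc q
  ... | yes j<n = lookup₀-applyUpTo _ j<n
  ... | no  j≮n = trans (lookup₀-beyond {u = freeBits k q ε} past-end) (sym (vanishes (3 + q + j) (s≤s (s≤s k≤))))
    where
    past-end : length (freeBits k q ε) ≤ j
    past-end = subst (_≤ j) (sym (length-applyUpTo _ _)) (≮⇒≥ j≮n)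
    k≤ : k ≤ suc q + j
    k≤ = subst (_≤ suc q + j) (m+[n∸m]≡n q<k) (+-monoʳ-≤ (suc q) (≮⇒≥ j≮n))

  biaugmentation-length : length (replicate q 1 ++ 0 ∷ freeBits k q ε) ≡ k
  biaugmentation-length = begin
    length (replicate q 1 ++ 0 ∷ freeBits k q ε)   ≡⟨ length-++ (replicate q 1) ⟩
    length (replicate q 1) + suc (length (freeBits k q ε))
      ≡⟨ cong₂ (λ a b → a + suc b) (length-replicate q) (length-applyUpTo _ (k ∸ suc q)) ⟩
    q + suc (k ∸ suc q)                            ≡⟨ +-suc q _ ⟩
    suc q + (k ∸ suc q)                            ≡⟨ m+[n∸m]≡n q<k ⟩
    k                                              ∎
    where open ≡-Reasoning

  biaugmentation-lookup₀ : ∀ i → lookup₀ (2 ∷ replicate q 1 ++ 0 ∷ freeBits k q ε) i ≡ ε (suc i)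
  biaugmentation-lookup₀ zero = sym ε₁≡2
  biaugmentation-lookup₀ (suc i) with i <? q
  ... | yes i<q = trans (lookup₀-++ˡ {u = replicate q 1} i<len)
                   (trans (lookup₀-All {P = _≡ 1} (replicate⁺ q refl) i<len)
                          (sym (ones (2 + i) (s≤s (s≤s z≤n)) (s≤s i<q))))
    where
    i<len : i < length (replicate q 1)
    i<len = subst (i <_) (sym (length-replicate q)) i<q
  ... | no i≮q with m≤n⇒∃[o]m+o≡n (≮⇒≥ i≮q)
  ...   | zero , refl = trans (lookup₀-++ʳ {u = replicate q 1} (length-replicate q))
                          (sym (subst (λ n → ε (2 + n) ≡ 0) (sym (+-identityʳ q)) hole))
  ...   | suc j , refl = trans (lookup₀-++ʳ {u = replicate q 1} (length-replicate q))
                           (trans (lookup₀-freeBits j) (cong (λ n → ε (2 + n)) (sym (+-suc q j))))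

-- 1 ≤ k is implied by q < k.
mainTheorem6 : (k q : ℕ) → 1 ≤ k → q < k → (ε : Seq) → IsBiaugmentation k q ε →
    HasDepth (M k ⊕ ε) (q * (k + 2) + 2)
mainTheorem6 k q _ q<k ε biaug =
  HasDepth-cong (pointwise λ i → cong (M k (suc i) +_) (biaugmentation-lookup₀ q<k biaug i))
    (depth-from q (biaugmentation-length q<k biaug) (freeBits-≤1 q<k biaug))
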